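{- Let $q$ be a prime power, $n$ a positive integer, and let $f(x)$ be an irreducible polynomial of degree $d$ over $\mathbb{F}_q$ dividing $x^n-1$. Let $\omega$ be a root of $f$ in an extension field, so that $\{1,\omega,\dots,\omega^{d-1}\}$ is a basis of $\mathbb{F}_q[\omega]$ over $\mathbb{F}_q$, and for $1\le i\le n$ write \[\omega^i=a_{i1}+a_{i2}\omega+\dots+a_{id}\omega^{d-1},\qquad a_{ij}\in\mathbb{F}_q.\] Then there exists a $(d-1)$-dimensional $\mathbb{F}_q$-subspace $V$ of $\mathbb{F}_q[\omega]$ with $\bigcup_{i=0}^{n-1}\omega^iV=\mathbb{F}_q[\omega]$ if and only if for every $(x_1,\dots,x_d)\in(\mathbb{F}_q^*)^d$ there exists an integer $i$ with $d\le i\le n$ such that \[x_1a_{i1}+x_2a_{i2}+\dots+x_da_{id}=0.\]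
   Context: Here $\omega^iV=\{\omega^iv: v\in V\}$; i.e., the covering is with respect to the $\mathbb{F}_q$-linear map of multiplication by $\omega$ on $\mathbb{F}_q[\omega]$ (which corresponds to multiplication by $x$ on $\mathbb{F}_q[x]/(f(x))$). -}

module Defs where

open import Level using (Level; _⊔_) renaming (suc to lsuc)
open import Data.Nat using (ℕ; zero; suc; _≤_; _<_; _^_)
open import Data.Nat.Primality using (Prime)
open import Data.Fin using (Fin; zero; suc; fromℕ; inject₁)
open import Data.List using (List; []; _∷_; map; replicate; _++_)
open import Data.Product using (Σ; ∃; ∃-syntax; _×_; _,_)
open import Data.Sum using (_⊎_)
open import Relation.Nullary using (¬_)
open import Relation.Binary.Definitions using (Decidable)
open import Relation.Binary.PropositionalEquality using (_≡_)
open import Algebra.Bundles using (CommutativeRing)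

IsPrimePower : ℕ → Set
IsPrimePower q = ∃[ p ] ∃[ k ] (Prime p × q ≡ p ^ suc k)

record Field (c ℓ : Level) : Set (lsuc (c ⊔ ℓ)) where
  field
    commutativeRing : CommutativeRing c ℓ
  open CommutativeRing commutativeRing public
  field
    _⁻¹     : Carrier → Carrier
    0≉1     : ¬ (0# ≈ 1#)
    ⁻¹-inverse : ∀ x → ¬ (x ≈ 0#) → x * (x ⁻¹) ≈ 1#

record FiniteField (c ℓ : Level) (q : ℕ) : Set (lsuc (c ⊔ ℓ)) where
  field
    field′ : Field c ℓ
  open Field field′ public
  field
    enum      : Fin q → Carrier
    enum-inj  : ∀ i j → enum i ≈ enum j → i ≡ j
    enum-surj : ∀ x → ∃[ i ] (enum i ≈ x)
    _≟_       : Decidable _≈_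

module FieldTheory {c ℓ : Level} (F : Field c ℓ) where
  open Field F using (Carrier; _≈_; _+_; _*_; -_; _-_; 0#; 1#; _⁻¹)

  -- Polynomials over F: coefficient lists, constant term first.
  Poly : Set c
  Poly = List Carrier

  coeff : Poly → ℕ → Carrier
  coeff []       _       = 0#
  coeff (a ∷ p)  zero    = a
  coeff (a ∷ p)  (suc k) = coeff p k

  _+ₚ_ : Poly → Poly → Poly
  []      +ₚ q       = q
  (a ∷ p) +ₚ []      = a ∷ p
  (a ∷ p) +ₚ (b ∷ q) = (a + b) ∷ (p +ₚ q)

  _*ₚ_ : Poly → Poly → Poly
  []      *ₚ q = []
  (a ∷ p) *ₚ q = map (a *_) q +ₚ (0# ∷ (p *ₚ q))

  _≈ₚ_ : Poly → Poly → Set ℓ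
  p ≈ₚ q = ∀ k → coeff p k ≈ coeff q k

  xⁿ-1 : ℕ → Poly
  xⁿ-1 n = (replicate n 0# ++ (1# ∷ [])) +ₚ ((- 1#) ∷ [])

  _∣ₚ_ : Poly → Poly → Set (c ⊔ ℓ)
  f ∣ₚ g = ∃[ h ] ((f *ₚ h) ≈ₚ g)

  HasDegree : Poly → ℕ → Set ℓ
  HasDegree p d = (¬ (coeff p d ≈ 0#)) × (∀ k → d < k → coeff p k ≈ 0#)

  IsConstant : Poly → Set ℓ
  IsConstant p = ∀ k → 1 ≤ k → coeff p k ≈ 0#

  Irreducible : Poly → Set (c ⊔ ℓ)
  Irreducible p = (¬ IsConstant p) × (∀ g h → p ≈ₚ (g *ₚ h) → IsConstant g ⊎ IsConstant h)

  Vecᶠ : ℕ → Set c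
  Vecᶠ m = Fin m → Carrier

  _≈ᵥ_ : ∀ {m} → Vecᶠ m → Vecᶠ m → Set ℓ
  u ≈ᵥ v = ∀ k → u k ≈ v k

  sumᶠ : ∀ {m} → Vecᶠ m → Carrier
  sumᶠ {zero}  v = 0#
  sumᶠ {suc m} v = v zero + sumᶠ (λ k → v (suc k))

  lincomb : ∀ {m d} → Vecᶠ m → (Fin m → Vecᶠ d) → Vecᶠ d
  lincomb c b k = sumᶠ (λ t → c t * b t k)

  LinIndep : ∀ {m d} → (Fin m → Vecᶠ d) → Set (c ⊔ ℓ)
  LinIndep b = ∀ cs → lincomb cs b ≈ᵥ (λ _ → 0#) → ∀ t → cs t ≈ 0#

  record Subspace (d : ℕ) : Set (lsuc (c ⊔ ℓ)) where
    field
      member  : Vecᶠ d → Set (c ⊔ ℓ)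
      respect : ∀ {u v} → u ≈ᵥ v → member u → member v
      has-0   : member (λ _ → 0#)
      closed+ : ∀ {u v} → member u → member v → member (λ k → u k + v k)
      closed* : ∀ a {u} → member u → member (λ k → a * u k)

  HasDim : ∀ {d} → Subspace d → ℕ → Set (c ⊔ ℓ)
  HasDim {d} V m = ∃[ b ] (LinIndep {m} {d} b
                          × (∀ t → Subspace.member V (b t))
                          × (∀ v → Subspace.member V v → ∃[ cs ] (v ≈ᵥ lincomb cs b)))

  -- F[ω] = F[x]/(f) for f of degree d, in coordinates w.r.t. the basis
  -- 1, ω, …, ω^(d-1):  a vector v represents Σ_k v_k ω^k.
  -- Multiplication by ω, using ω^d = - lc⁻¹ Σ_{k<d} f_k ω^k, lc = coeff f d.
  mulω : (f : Poly) (d : ℕ) → Vecᶠ d → Vecᶠ d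
  mulω f zero    v = v
  mulω f (suc m) v k = shift k - ((coeff f (suc m) ⁻¹) * coeff f (Data.Fin.toℕ k)) * v (fromℕ m)
    where
    shift : Fin (suc m) → Carrier
    shift zero    = 0#
    shift (suc j) = v (inject₁ j)

  powω : (f : Poly) (d : ℕ) → ℕ → Vecᶠ d → Vecᶠ d
  powω f d zero    v = v
  powω f d (suc i) v = mulω f d (powω f d i v)

  oneω : ∀ {d} → Vecᶠ d
  oneω zero    = 1#
  oneω (suc _) = 0#

  -- a i j : the coefficient of ω^j (j = 0 … d-1) in ω^i,
  -- i.e. the paper's a_{i,j+1}
  coord : (f : Poly) (d : ℕ) → ℕ → Fin d → Carrier
  coord f d i = powω f d i oneω

-- Identify F[ω] with F^d through the basis 1, ω, …, ω^(d-1); multiplication by ω is the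
-- companion map mulω, and ω^n = 1 because f divides x^n - 1, so powers of ω can be undone.
--
-- (⇐) The hyperplane W = {v : v₀ = 0} covers. Given v, let y_j = (ω^j v)₀ for j < d. If some
-- y_j vanishes then ω^j v ∈ W; otherwise y is nowhere zero and the condition gives d ≤ i ≤ n
-- with (ω^i v)₀ = Σ_j a_ij y_j = 0. Either way a power of ω moves v into W.
--
-- (⇒) Let W of dimension d - 1 cover and let x be given. The d - 1 linear conditions
-- x · w(ω) b_s = 0 on the d coefficients of w have a nonzero solution, found by pigeonhole
-- over the finite field. As f is irreducible, w(ω) is invertible: w(ω) y = 1 for some y.
-- Writing y = ω^i u with u ∈ W gives ω^(n-i) = w(ω) u, hence x · ω^(n-i) = 0; and n - i ≥ d,
-- since ω^j is the j-th basis vector for j < d while x is nowhere zero.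

module Submission where

open import Defs
open import Data.Nat using (ℕ; _≤_; _<_; _∸_)
open import Data.Product using (∃-syntax; _×_)
open import Relation.Nullary using (¬_)
open import Function.Bundles using (_⇔_)

open import Level using (Lift; lift; _⊔_)
open import Data.Nat as ℕ using (zero; suc; z≤n; s≤s)
import Data.Nat.Properties as ℕₚ
open import Data.Fin as Fin using (Fin; zero; suc; toℕ; fromℕ; fromℕ<; inject₁)
import Data.Fin.Properties as Finₚ
open import Data.List using ([]; _∷_; map; replicate; _++_)
open import Data.Product using (_,_; proj₁; proj₂; uncurry)
open import Data.Sum using (_⊎_; inj₁; inj₂; [_,_]′)
open import Data.Empty using (⊥-elim)
open import Relation.Nullary using (Dec; yes; no)
open import Relation.Binary.PropositionalEquality as ≡ using (_≡_; _≢_)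
open import Relation.Binary.Definitions using (Decidable; Tri; tri<; tri≈; tri>)
open import Function using (_∘_; id)
open import Function.Bundles using (mk⇔)

module LinearAlgebra {c ℓ} (F : Field c ℓ) where
  open Field F hiding (zero)
  open FieldTheory F
  open import Algebra.Properties.Semiring.Sum semiring
    using (sum; sum-cong-≋; sum-replicate-zero; ∑-distrib-+; *-distribˡ-sum)
  open import Algebra.Properties.CommutativeSemigroup *-commutativeSemigroup using (x∙yz≈y∙xz)
  open import Relation.Binary.Reasoning.Setoid setoid

  private variable
    D D′ t : ℕ

  𝟎 : Vecᶠ D
  𝟎 _ = 0#

  infixl 26 _⊕_
  infixr 27 _⊙_

  _⊕_ : Vecᶠ D → Vecᶠ D → Vecᶠ D
  (u ⊕ v) k = u k + v k

  _⊙_ : Carrier → Vecᶠ D → Vecᶠ D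
  (a ⊙ v) k = a * v k

  sumᶠ≡sum : (v : Vecᶠ t) → sumᶠ v ≡ sum v
  sumᶠ≡sum {zero} v = ≡.refl
  sumᶠ≡sum {suc t} v = ≡.cong (v zero +_) (sumᶠ≡sum (λ k → v (suc k)))

  sumᶠ-cong : {u v : Vecᶠ t} → u ≈ᵥ v → sumᶠ u ≈ sumᶠ v
  sumᶠ-cong {u = u} {v} u≈v rewrite sumᶠ≡sum u | sumᶠ≡sum v = sum-cong-≋ u≈v

  sumᶠ-zero : (v : Vecᶠ t) → v ≈ᵥ 𝟎 → sumᶠ v ≈ 0#
  sumᶠ-zero {t} v v≈𝟎 rewrite sumᶠ≡sum v = trans (sum-cong-≋ v≈𝟎) (sum-replicate-zero t)

  sumᶠ-⊕ : (u v : Vecᶠ t) → sumᶠ (u ⊕ v) ≈ sumᶠ u + sumᶠ v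
  sumᶠ-⊕ u v rewrite sumᶠ≡sum (u ⊕ v) | sumᶠ≡sum u | sumᶠ≡sum v = ∑-distrib-+ u v

  sumᶠ-⊙ : ∀ a (v : Vecᶠ t) → sumᶠ (a ⊙ v) ≈ a * sumᶠ v
  sumᶠ-⊙ a v rewrite sumᶠ≡sum (a ⊙ v) | sumᶠ≡sum v = sym (*-distribˡ-sum a v)

  δ : ℕ → ℕ → Carrier
  δ zero    zero    = 1#
  δ zero    (suc _) = 0#
  δ (suc _) zero    = 0#
  δ (suc i) (suc j) = δ i j

  δ-sym : ∀ i j → δ i j ≡ δ j i
  δ-sym zero    zero    = ≡.refl
  δ-sym zero    (suc j) = ≡.refl
  δ-sym (suc i) zero    = ≡.refl
  δ-sym (suc i) (suc j) = δ-sym i j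

  δ-diag : ∀ i → δ i i ≡ 1#
  δ-diag zero    = ≡.refl
  δ-diag (suc i) = δ-diag i

  δ-< : ∀ {i j} → i < j → δ i j ≡ 0#
  δ-< {zero}  {suc j} _         = ≡.refl
  δ-< {suc i} {suc j} (s≤s i<j) = δ-< i<j

  𝐞 : ℕ → Vecᶠ D
  𝐞 j k = δ (toℕ k) j

  record IsLinear (G : Vecᶠ D → Vecᶠ D′) : Set (c ⊔ ℓ) where
    field
      cong   : ∀ {u v} → u ≈ᵥ v → G u ≈ᵥ G v
      homo-⊕ : ∀ u v → G (u ⊕ v) ≈ᵥ G u ⊕ G v
      homo-⊙ : ∀ a u → G (a ⊙ u) ≈ᵥ a ⊙ G u

    homo-𝟎 : G 𝟎 ≈ᵥ 𝟎
    homo-𝟎 k = begin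
      G 𝟎 k        ≈⟨ cong (λ _ → sym (zeroˡ 0#)) k ⟩
      G (0# ⊙ 𝟎) k ≈⟨ homo-⊙ 0# 𝟎 k ⟩
      0# * G 𝟎 k   ≈⟨ zeroˡ _ ⟩
      0#           ∎

    homo-lincomb : (cs : Vecᶠ t) (b : Fin t → Vecᶠ D) → G (lincomb cs b) ≈ᵥ lincomb cs (λ s → G (b s))
    homo-lincomb {zero}  cs b = homo-𝟎
    homo-lincomb {suc t} cs b k = begin
      G (cs zero ⊙ b zero ⊕ lincomb (λ s → cs (suc s)) (λ s → b (suc s))) k
        ≈⟨ homo-⊕ _ _ k ⟩
      G (cs zero ⊙ b zero) k + G (lincomb (λ s → cs (suc s)) (λ s → b (suc s))) k
        ≈⟨ +-cong (homo-⊙ _ _ k) (homo-lincomb (λ s → cs (suc s)) (λ s → b (suc s)) k) ⟩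
      cs zero * G (b zero) k + lincomb (λ s → cs (suc s)) (λ s → G (b (suc s))) k ∎

  open IsLinear public

  id-linear : IsLinear {D} (λ v → v)
  id-linear = record { cong = λ u≈v → u≈v ; homo-⊕ = λ _ _ _ → refl ; homo-⊙ = λ _ _ _ → refl }

  ∘-linear : ∀ {D″} {G : Vecᶠ D′ → Vecᶠ D″} {H : Vecᶠ D → Vecᶠ D′} →
             IsLinear G → IsLinear H → IsLinear (λ v → G (H v))
  ∘-linear {G = G} {H} G-lin H-lin = record
    { cong   = λ u≈v → cong G-lin (cong H-lin u≈v)
    ; homo-⊕ = λ u v k → trans (cong G-lin (homo-⊕ H-lin u v) k) (homo-⊕ G-lin (H u) (H v) k)
    ; homo-⊙ = λ a u k → trans (cong G-lin (homo-⊙ H-lin a u) k) (homo-⊙ G-lin a (H u) k)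
    }

  lincomb-linear : (b : Fin t → Vecᶠ D) → IsLinear (λ cs → lincomb cs b)
  lincomb-linear b = record
    { cong   = λ u≈v k → sumᶠ-cong (λ s → *-congʳ (u≈v s))
    ; homo-⊕ = λ u v k → trans (sumᶠ-cong (λ s → distribʳ (b s k) (u s) (v s)))
                                (sumᶠ-⊕ (λ s → u s * b s k) (λ s → v s * b s k))
    ; homo-⊙ = λ a u k → trans (sumᶠ-cong (λ s → *-assoc a (u s) (b s k))) (sumᶠ-⊙ a (λ s → u s * b s k))
    }

  infix 8 _·_

  _·_ : Vecᶠ D → Vecᶠ D → Carrier
  x · v = sumᶠ (λ j → x j * v j)

  ·-cong : ∀ (x : Vecᶠ D) {u v} → u ≈ᵥ v → x · u ≈ x · v
  ·-cong x u≈v = sumᶠ-cong (λ j → *-congˡ (u≈v j))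

  ·-⊕ : ∀ (x u v : Vecᶠ D) → x · (u ⊕ v) ≈ x · u + x · v
  ·-⊕ x u v = trans (sumᶠ-cong (λ j → distribˡ (x j) (u j) (v j)))
                  (sumᶠ-⊕ (λ j → x j * u j) (λ j → x j * v j))

  ·-⊙ : ∀ (x : Vecᶠ D) a u → x · (a ⊙ u) ≈ a * x · u
  ·-⊙ x a u = trans (sumᶠ-cong (λ j → x∙yz≈y∙xz (x j) a (u j))) (sumᶠ-⊙ a (λ j → x j * u j))

  ·-lincomb : ∀ (x : Vecᶠ D) (cs : Vecᶠ t) b → x · lincomb cs b ≈ sumᶠ (λ s → cs s * x · b s)
  ·-lincomb {D} {zero} x cs b = sumᶠ-zero (λ j → x j * 0#) (λ _ → zeroʳ _)
  ·-lincomb {D} {suc t} x cs b = begin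
    x · (cs zero ⊙ b zero ⊕ lincomb (λ s → cs (suc s)) (λ s → b (suc s)))
      ≈⟨ ·-⊕ x _ _ ⟩
    x · (cs zero ⊙ b zero) + x · lincomb (λ s → cs (suc s)) (λ s → b (suc s))
      ≈⟨ +-cong (·-⊙ x _ _) (·-lincomb x (λ s → cs (suc s)) (λ s → b (suc s))) ⟩
    cs zero * x · b zero + sumᶠ (λ s → cs (suc s) * x · b (suc s)) ∎

  ·-𝐞 : (x : Vecᶠ D) (j : Fin D) → x · 𝐞 (toℕ j) ≈ x j
  ·-𝐞 x zero = begin
    x zero * 1# + sumᶠ (λ k → x (suc k) * 0#)
      ≈⟨ +-cong (*-identityʳ _) (sumᶠ-zero (λ k → x (suc k) * 0#) (λ _ → zeroʳ _)) ⟩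
    x zero + 0#
      ≈⟨ +-identityʳ _ ⟩
    x zero ∎
  ·-𝐞 x (suc j) = begin
    x zero * 0# + (λ k → x (suc k)) · 𝐞 (toℕ j) ≈⟨ +-cong (zeroʳ _) (·-𝐞 (λ k → x (suc k)) j) ⟩
    0# + x (suc j)                              ≈⟨ +-identityˡ _ ⟩
    x (suc j)                                   ∎

  lincomb-𝐞 : (w : Vecᶠ t) → lincomb w (λ j → 𝐞 (toℕ j)) ≈ᵥ w
  lincomb-𝐞 {t} w k = trans (sumᶠ-cong {t} (λ j → *-congˡ (reflexive (δ-sym (toℕ k) (toℕ j))))) (·-𝐞 w k)

module FieldProperties {c ℓ} (F : Field c ℓ) where
  open Field F hiding (zero)
  open import Algebra.Properties.Ring ring using (-‿distribʳ-*)
  open import Algebra.Solver.Ring.NaturalCoefficients.Default commutativeSemiring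
    using (solve; _:=_; _:+_)
  open import Relation.Binary.Reasoning.Setoid setoid

  ⁻¹-inverseˡ : ∀ x → ¬ (x ≈ 0#) → x ⁻¹ * x ≈ 1#
  ⁻¹-inverseˡ x x≉0 = trans (*-comm _ _) (⁻¹-inverse x x≉0)

  +-insert-inverse : ∀ x y z → y + z ≈ (x + y) + (z + - x)
  +-insert-inverse x y z = begin
    y + z                  ≈⟨ sym (+-identityʳ _) ⟩
    (y + z) + 0#           ≈⟨ +-congˡ (sym (-‿inverseʳ x)) ⟩
    (y + z) + (x + - x)    ≈⟨ solve 4 (λ x y z x′ → (y :+ z) :+ (x :+ x′) := (x :+ y) :+ (z :+ x′)) refl x y z (- x) ⟩
    (x + y) + (z + - x)    ∎

  x+y*-[y⁻¹*x]≈0 : ∀ x y → ¬ (y ≈ 0#) → x + y * - (y ⁻¹ * x) ≈ 0#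
  x+y*-[y⁻¹*x]≈0 x y y≉0 = begin
    x + y * - (y ⁻¹ * x)   ≈⟨ +-congˡ (-‿distribʳ-* y _) ⟨
    x + - (y * (y ⁻¹ * x)) ≈⟨ +-congˡ (-‿cong (*-assoc y _ x)) ⟨
    x + - (y * y ⁻¹ * x)   ≈⟨ +-congˡ (-‿cong (*-congʳ (⁻¹-inverse y y≉0))) ⟩
    x + - (1# * x)         ≈⟨ +-congˡ (-‿cong (*-identityˡ x)) ⟩
    x + - x                ≈⟨ -‿inverseʳ x ⟩
    0#                     ∎

module Polynomials {c ℓ} (F : Field c ℓ) where
  open Field F hiding (zero)
  open FieldTheory F
  open FieldProperties F
  open import Algebra.Properties.Ring ring using (-‿distribˡ-*)
  open import Relation.Binary.Reasoning.Setoid setoid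

  private variable
    t : ℕ

  DegreeBelow : Poly → ℕ → Set ℓ
  DegreeBelow p e = ∀ k → e ≤ k → coeff p k ≈ 0#

  degreeBelow-pred : ∀ {p e} → DegreeBelow p (suc e) → coeff p e ≈ 0# → DegreeBelow p e
  degreeBelow-pred {e = e} p<e+1 p_e≈0 k e≤k with ℕₚ.m≤n⇒m<n∨m≡n e≤k
  ... | inj₁ e<k    = p<e+1 k e<k
  ... | inj₂ ≡.refl = p_e≈0

  hasDegree⇒degreeBelow : ∀ {p e B} → HasDegree p e → e < B → DegreeBelow p B
  hasDegree⇒degreeBelow (_ , p-top) e<B k B≤k = p-top k (ℕₚ.<-≤-trans e<B B≤k)

  coeff-+ₚ : ∀ p p′ k → coeff (p +ₚ p′) k ≈ coeff p k + coeff p′ k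
  coeff-+ₚ []      p′       k       = sym (+-identityˡ _)
  coeff-+ₚ (a ∷ p) []       k       = sym (+-identityʳ _)
  coeff-+ₚ (a ∷ p) (b ∷ p′) zero    = refl
  coeff-+ₚ (a ∷ p) (b ∷ p′) (suc k) = coeff-+ₚ p p′ k

  coeff-map-* : ∀ a p k → coeff (map (a *_) p) k ≈ a * coeff p k
  coeff-map-* a []      k       = sym (zeroʳ a)
  coeff-map-* a (b ∷ p) zero    = refl
  coeff-map-* a (b ∷ p) (suc k) = coeff-map-* a p k

  coeff-*ₚ-constant : ∀ h g → IsConstant h → ∀ k → coeff (h *ₚ g) k ≈ coeff h 0 * coeff g k
  coeff-*ₚ-constant []      g _ k = sym (zeroˡ _)
  coeff-*ₚ-constant (a ∷ h) g h-const k = begin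
    coeff (map (a *_) g +ₚ (0# ∷ (h *ₚ g))) k ≈⟨ coeff-+ₚ (map (a *_) g) _ k ⟩
    coeff (map (a *_) g) k + coeff (0# ∷ (h *ₚ g)) k ≈⟨ +-cong (coeff-map-* a g k) (shifted-vanishes k) ⟩
    a * coeff g k + 0#                                ≈⟨ +-identityʳ _ ⟩
    a * coeff g k                                     ∎
    where
    shifted-vanishes : ∀ k → coeff (0# ∷ (h *ₚ g)) k ≈ 0#
    shifted-vanishes zero    = refl
    shifted-vanishes (suc k) = begin
      coeff (h *ₚ g) k         ≈⟨ coeff-*ₚ-constant h g (λ j _ → h-const (suc j) (s≤s z≤n)) k ⟩
      coeff h 0 * coeff g k    ≈⟨ *-congʳ (h-const 1 (s≤s z≤n)) ⟩
      0# * coeff g k           ≈⟨ zeroˡ _ ⟩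
      0#                       ∎

  toPoly : Vecᶠ t → Poly
  toPoly {zero}  w = []
  toPoly {suc t} w = w zero ∷ toPoly (λ k → w (suc k))

  coeff-toPoly : (w : Vecᶠ t) (j : Fin t) → coeff (toPoly w) (toℕ j) ≡ w j
  coeff-toPoly w zero    = ≡.refl
  coeff-toPoly w (suc j) = coeff-toPoly (λ k → w (suc k)) j

  toPoly-zero : (w : Vecᶠ t) → (∀ k → coeff (toPoly w) k ≈ 0#) → w ≈ᵥ (λ _ → 0#)
  toPoly-zero w toPoly-w≈0 j = trans (sym (reflexive (coeff-toPoly w j))) (toPoly-w≈0 (toℕ j))

  coeff-toPoly-< : ∀ (g : ℕ → Carrier) {k} → k < t → coeff (toPoly {t} (λ j → g (toℕ j))) k ≡ g k
  coeff-toPoly-< {suc t} g {zero}  _         = ≡.refl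
  coeff-toPoly-< {suc t} g {suc k} (s≤s k<t) = coeff-toPoly-< (λ i → g (suc i)) k<t

  toPoly-degree : (w : Vecᶠ t) → DegreeBelow (toPoly w) t
  toPoly-degree {zero}  w k       _         = refl
  toPoly-degree {suc t} w (suc k) (s≤s t≤k) = toPoly-degree (λ j → w (suc j)) k t≤k

  monomial : Carrier → ℕ → Poly
  monomial a i = replicate i 0# ++ (a ∷ [])

  coeff-monomial-< : ∀ a {i k} → k < i → coeff (monomial a i) k ≡ 0#
  coeff-monomial-< a {suc i} {zero}  _         = ≡.refl
  coeff-monomial-< a {suc i} {suc k} (s≤s k<i) = coeff-monomial-< a k<i

  coeff-monomial-≡ : ∀ a i → coeff (monomial a i) i ≡ a
  coeff-monomial-≡ a zero    = ≡.refl
  coeff-monomial-≡ a (suc i) = coeff-monomial-≡ a i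

  coeff-monomial-> : ∀ a {i k} → i < k → coeff (monomial a i) k ≡ 0#
  coeff-monomial-> a {zero}  {suc k} _         = ≡.refl
  coeff-monomial-> a {suc i} {suc k} (s≤s i<k) = coeff-monomial-> a i<k

  split-leading : ∀ {f d} → HasDegree f d →
                  f ≈ₚ (toPoly {d} (λ j → coeff f (toℕ j)) +ₚ monomial (coeff f d) d)
  split-leading {f} {d} (_ , f-top) k =
    sym (trans (coeff-+ₚ low (monomial (coeff f d) d) k) (by-cases (ℕₚ.<-cmp k d)))
    where
    low = toPoly {d} (λ j → coeff f (toℕ j))
    by-cases : Tri (k < d) (k ≡ d) (d < k) → coeff low k + coeff (monomial (coeff f d) d) k ≈ coeff f k
    by-cases (tri< k<d _ _) =
      trans (+-cong (reflexive (coeff-toPoly-< (coeff f) k<d)) (reflexive (coeff-monomial-< _ k<d))) (+-identityʳ _)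
    by-cases (tri≈ _ ≡.refl _) =
      trans (+-cong (toPoly-degree _ k ℕₚ.≤-refl) (reflexive (coeff-monomial-≡ _ d))) (+-identityˡ _)
    by-cases (tri> _ _ d<k) =
      trans (+-cong (toPoly-degree _ k (ℕₚ.<⇒≤ d<k)) (reflexive (coeff-monomial-> _ d<k)))
            (trans (+-identityˡ 0#) (sym (f-top k d<k)))

  division : ∀ {g e} → HasDegree g e → ∀ p → ∃[ h ] ∃[ r ] (DegreeBelow r e × p ≈ₚ ((h *ₚ g) +ₚ r))
  division g-degree [] = [] , [] , (λ _ _ → refl) , (λ _ → refl)
  division {g} {e} g-degree@(g-lead≉0 , g-top) (a ∷ p) with division g-degree p
  ... | h , r , r<e , p≈ = (c₀ ∷ h) , r′ , r′<e , a∷p≈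
    where
    -- a ∷ p = (x h) g + (a ∷ r), and subtracting c₀ g cancels the coefficient of x^e.
    s : Poly
    s = a ∷ r
    c₀ : Carrier
    c₀ = coeff g e ⁻¹ * coeff s e
    r′ : Poly
    r′ = s +ₚ map (- c₀ *_) g

    coeff-r′ : ∀ k → coeff r′ k ≈ coeff s k + - c₀ * coeff g k
    coeff-r′ k = trans (coeff-+ₚ s (map (- c₀ *_) g) k) (+-congˡ (coeff-map-* (- c₀) g k))

    r′<e : DegreeBelow r′ e
    r′<e k e≤k with ℕₚ.m≤n⇒m<n∨m≡n e≤k
    ... | inj₂ ≡.refl = trans (coeff-r′ e) (trans (+-congˡ (*-comm _ _)) (x+y*-[y⁻¹*x]≈0 _ _ g-lead≉0))
    r′<e (suc k) _ | inj₁ (s≤s e≤k) =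
      trans (coeff-r′ (suc k)) (trans (+-cong (r<e k e≤k) (trans (*-congˡ (g-top (suc k) (s≤s e≤k))) (zeroʳ _)))
                                      (+-identityʳ 0#))

    shift : ∀ k → coeff (a ∷ p) k ≈ coeff (0# ∷ (h *ₚ g)) k + coeff s k
    shift zero    = sym (+-identityˡ a)
    shift (suc k) = trans (p≈ k) (coeff-+ₚ (h *ₚ g) r k)

    a∷p≈ : (a ∷ p) ≈ₚ (((c₀ ∷ h) *ₚ g) +ₚ r′)
    a∷p≈ k = begin
      coeff (a ∷ p) k
        ≈⟨ shift k ⟩
      coeff (0# ∷ (h *ₚ g)) k + coeff s k
        ≈⟨ +-insert-inverse (c₀ * coeff g k) _ _ ⟩
      (c₀ * coeff g k + coeff (0# ∷ (h *ₚ g)) k) + (coeff s k + - (c₀ * coeff g k))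
        ≈⟨ +-cong (sym (trans (coeff-+ₚ (map (c₀ *_) g) _ k) (+-congʳ (coeff-map-* c₀ g k))))
                  (trans (+-congˡ (-‿distribˡ-* c₀ _)) (sym (coeff-r′ k))) ⟩
      coeff ((c₀ ∷ h) *ₚ g) k + coeff r′ k
        ≈⟨ sym (coeff-+ₚ ((c₀ ∷ h) *ₚ g) r′ k) ⟩
      coeff (((c₀ ∷ h) *ₚ g) +ₚ r′) k ∎

module Horner {c ℓ} (F : Field c ℓ) {D : ℕ} (M : FieldTheory.Vecᶠ F D → FieldTheory.Vecᶠ F D)
              (M-linear : LinearAlgebra.IsLinear F M) where
  open Field F hiding (zero)
  open FieldTheory F
  open LinearAlgebra F
  open Polynomials F
  open FieldProperties F using (⁻¹-inverseˡ)
  open import Algebra.Properties.Ring ring using (-1*x≈-x)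
  open import Algebra.Properties.AbelianGroup +-abelianGroup using (inverseʳ-unique)
  open import Algebra.Solver.Ring.NaturalCoefficients.Default commutativeSemiring
    using (solve; _:=_; _:+_; _:*_)
  open import Relation.Binary.Reasoning.Setoid setoid

  private
    V : Set c
    V = Vecᶠ D

  pow : ℕ → V → V
  pow zero    v = v
  pow (suc i) v = M (pow i v)

  pow-linear : ∀ i → IsLinear (pow i)
  pow-linear zero    = id-linear
  pow-linear (suc i) = ∘-linear M-linear (pow-linear i)

  pow-+ : ∀ i j v → pow i (pow j v) ≈ᵥ pow (i ℕ.+ j) v
  pow-+ zero    j v _ = refl
  pow-+ (suc i) j v   = cong M-linear (pow-+ i j v)

  pow-M : ∀ i v → pow i (M v) ≈ᵥ M (pow i v)
  pow-M zero    v _ = refl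
  pow-M (suc i) v   = cong M-linear (pow-M i v)

  pow-inverse : ∀ {n} → 1 ≤ n → (∀ v → pow n v ≈ᵥ v) → ∀ k v → ∃[ i ] (i < n × pow i (pow k v) ≈ᵥ v)
  pow-inverse n≥1 periodic zero v = 0 , n≥1 , λ _ → refl
  pow-inverse {suc n} n≥1 periodic (suc k) v with pow-inverse n≥1 periodic k v
  ... | zero , _ , ωᵏv≈v =
    n , ℕₚ.n<1+n n , λ j → trans (pow-M n (pow k v) j) (trans (periodic (pow k v) j) (ωᵏv≈v j))
  ... | suc i , s≤s i<n , ωⁱ⁺¹ωᵏv≈v =
    i , ℕₚ.m<n⇒m<1+n i<n , λ j → trans (pow-M i (pow k v) j) (ωⁱ⁺¹ωᵏv≈v j)

  pow-undo : ∀ {n i u v} → (∀ v → pow n v ≈ᵥ v) → i ≤ n → pow i u ≈ᵥ v → u ≈ᵥ pow (n ∸ i) v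
  pow-undo {n} {i} {u} {v} periodic i≤n ωⁱu≈v k = begin
    u k                      ≈⟨ periodic u k ⟨
    pow n u k                ≡⟨ ≡.cong (λ e → pow e u k) (ℕₚ.m∸n+n≡m i≤n) ⟨
    pow (n ∸ i ℕ.+ i) u k    ≈⟨ pow-+ (n ∸ i) i u k ⟨
    pow (n ∸ i) (pow i u) k  ≈⟨ cong (pow-linear (n ∸ i)) ωⁱu≈v k ⟩
    pow (n ∸ i) v k          ∎

  eval : Poly → V → V
  eval []      v = 𝟎
  eval (a ∷ p) v = a ⊙ v ⊕ M (eval p v)

  eval-linear : ∀ p → IsLinear (eval p)
  eval-linear []      = record
    { cong = λ _ _ → refl ; homo-⊕ = λ _ _ _ → sym (+-identityʳ 0#) ; homo-⊙ = λ a _ _ → sym (zeroʳ a) }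
  eval-linear (a ∷ p) = record { cong = eval-cong-v ; homo-⊕ = eval-⊕ ; homo-⊙ = eval-⊙ }
    where
    eval-cong-v : ∀ {u v} → u ≈ᵥ v → eval (a ∷ p) u ≈ᵥ eval (a ∷ p) v
    eval-cong-v u≈v k = +-cong (*-congˡ (u≈v k)) (cong M-linear (cong (eval-linear p) u≈v) k)
    eval-⊕ : ∀ u v → eval (a ∷ p) (u ⊕ v) ≈ᵥ eval (a ∷ p) u ⊕ eval (a ∷ p) v
    eval-⊕ u v k = begin
      a * (u k + v k) + M (eval p (u ⊕ v)) k
        ≈⟨ +-congˡ (trans (cong M-linear (homo-⊕ (eval-linear p) u v) k) (homo-⊕ M-linear _ _ k)) ⟩
      a * (u k + v k) + (M (eval p u) k + M (eval p v) k)
        ≈⟨ solve 5 (λ a x y s t → a :* (x :+ y) :+ (s :+ t) := (a :* x :+ s) :+ (a :* y :+ t)) refl a (u k) (v k) _ _ ⟩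
      (a * u k + M (eval p u) k) + (a * v k + M (eval p v) k) ∎
    eval-⊙ : ∀ b u → eval (a ∷ p) (b ⊙ u) ≈ᵥ b ⊙ eval (a ∷ p) u
    eval-⊙ b u k = begin
      a * (b * u k) + M (eval p (b ⊙ u)) k
        ≈⟨ +-congˡ (trans (cong M-linear (homo-⊙ (eval-linear p) b u) k) (homo-⊙ M-linear _ _ k)) ⟩
      a * (b * u k) + b * M (eval p u) k
        ≈⟨ solve 4 (λ a b x s → a :* (b :* x) :+ b :* s := b :* (a :* x :+ s)) refl a b (u k) _ ⟩
      b * (a * u k + M (eval p u) k) ∎

  eval-M : ∀ p v → eval p (M v) ≈ᵥ M (eval p v)
  eval-M []      v k = sym (homo-𝟎 M-linear k)
  eval-M (a ∷ p) v k = begin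
    a * M v k + M (eval p (M v)) k     ≈⟨ +-congˡ (cong M-linear (eval-M p v) k) ⟩
    a * M v k + M (M (eval p v)) k     ≈⟨ +-congʳ (homo-⊙ M-linear a v k) ⟨
    M (a ⊙ v) k + M (M (eval p v)) k   ≈⟨ homo-⊕ M-linear _ _ k ⟨
    M (a ⊙ v ⊕ M (eval p v)) k         ∎

  eval-pow : ∀ p i v → eval p (pow i v) ≈ᵥ pow i (eval p v)
  eval-pow p zero    v k = refl
  eval-pow p (suc i) v k = trans (eval-M p (pow i v) k) (cong M-linear (eval-pow p i v) k)

  eval-comm : ∀ p p′ v → eval p (eval p′ v) ≈ᵥ eval p′ (eval p v)
  eval-comm p []       v = homo-𝟎 (eval-linear p)
  eval-comm p (b ∷ p′) v k = begin
    eval p (b ⊙ v ⊕ M (eval p′ v)) k              ≈⟨ homo-⊕ (eval-linear p) _ _ k ⟩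
    eval p (b ⊙ v) k + eval p (M (eval p′ v)) k   ≈⟨ +-cong (homo-⊙ (eval-linear p) b v k) (eval-M p _ k) ⟩
    b * eval p v k + M (eval p (eval p′ v)) k     ≈⟨ +-congˡ (cong M-linear (eval-comm p p′ v) k) ⟩
    b * eval p v k + M (eval p′ (eval p v)) k     ∎

  eval-zero : ∀ p v → (∀ k → coeff p k ≈ 0#) → eval p v ≈ᵥ 𝟎
  eval-zero []      v p≈0 k = refl
  eval-zero (a ∷ p) v p≈0 k = begin
    a * v k + M (eval p v) k ≈⟨ +-cong (*-congʳ (p≈0 0)) (cong M-linear (eval-zero p v (λ j → p≈0 (suc j))) k) ⟩
    0# * v k + M 𝟎 k         ≈⟨ +-cong (zeroˡ _) (homo-𝟎 M-linear k) ⟩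
    0# + 0#                  ≈⟨ +-identityʳ _ ⟩
    0#                       ∎

  eval-cong : ∀ {p p′} v → p ≈ₚ p′ → eval p v ≈ᵥ eval p′ v
  eval-cong {[]}    {[]}     v _    k = refl
  eval-cong {[]}    {b ∷ p′} v p≈p′ k = sym (eval-zero (b ∷ p′) v (λ j → sym (p≈p′ j)) k)
  eval-cong {a ∷ p} {[]}     v p≈p′ k = eval-zero (a ∷ p) v p≈p′ k
  eval-cong {a ∷ p} {b ∷ p′} v p≈p′ k =
    +-cong (*-congʳ (p≈p′ 0)) (cong M-linear (eval-cong {p} {p′} v (λ j → p≈p′ (suc j))) k)

  eval-+ₚ : ∀ p p′ v → eval (p +ₚ p′) v ≈ᵥ eval p v ⊕ eval p′ v
  eval-+ₚ []      p′       v k = sym (+-identityˡ _)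
  eval-+ₚ (a ∷ p) []       v k = sym (+-identityʳ _)
  eval-+ₚ (a ∷ p) (b ∷ p′) v k = begin
    (a + b) * v k + M (eval (p +ₚ p′) v) k
      ≈⟨ +-congˡ (trans (cong M-linear (eval-+ₚ p p′ v) k) (homo-⊕ M-linear _ _ k)) ⟩
    (a + b) * v k + (M (eval p v) k + M (eval p′ v) k)
      ≈⟨ solve 5 (λ a b x s t → (a :+ b) :* x :+ (s :+ t) := (a :* x :+ s) :+ (b :* x :+ t)) refl a b (v k) _ _ ⟩
    (a * v k + M (eval p v) k) + (b * v k + M (eval p′ v) k) ∎

  eval-map-* : ∀ a p v → eval (map (a *_) p) v ≈ᵥ a ⊙ eval p v
  eval-map-* a []      v k = sym (zeroʳ a)
  eval-map-* a (b ∷ p) v k = begin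
    (a * b) * v k + M (eval (map (a *_) p) v) k
      ≈⟨ +-congˡ (trans (cong M-linear (eval-map-* a p v) k) (homo-⊙ M-linear _ _ k)) ⟩
    (a * b) * v k + a * M (eval p v) k
      ≈⟨ solve 4 (λ a b x s → (a :* b) :* x :+ a :* s := a :* (b :* x :+ s)) refl a b (v k) _ ⟩
    a * (b * v k + M (eval p v) k) ∎

  eval-*ₚ : ∀ p p′ v → eval (p *ₚ p′) v ≈ᵥ eval p (eval p′ v)
  eval-*ₚ []      p′ v k = refl
  eval-*ₚ (a ∷ p) p′ v k = begin
    eval (map (a *_) p′ +ₚ (0# ∷ (p *ₚ p′))) v k
      ≈⟨ eval-+ₚ (map (a *_) p′) _ v k ⟩
    eval (map (a *_) p′) v k + (0# * v k + M (eval (p *ₚ p′) v) k)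
      ≈⟨ +-cong (eval-map-* a p′ v k) (+-cong (zeroˡ _) (cong M-linear (eval-*ₚ p p′ v) k)) ⟩
    a * eval p′ v k + (0# + M (eval p (eval p′ v)) k)
      ≈⟨ +-congˡ (+-identityˡ _) ⟩
    a * eval p′ v k + M (eval p (eval p′ v)) k ∎

  eval-monomial : ∀ a i v → eval (monomial a i) v ≈ᵥ a ⊙ pow i v
  eval-monomial a zero    v k = trans (+-congˡ (homo-𝟎 M-linear k)) (+-identityʳ _)
  eval-monomial a (suc i) v k = begin
    0# * v k + M (eval (monomial a i) v) k ≈⟨ +-cong (zeroˡ _) (cong M-linear (eval-monomial a i v) k) ⟩
    0# + M (a ⊙ pow i v) k                 ≈⟨ +-identityˡ _ ⟩
    M (a ⊙ pow i v) k                      ≈⟨ homo-⊙ M-linear a (pow i v) k ⟩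
    a * M (pow i v) k                      ∎

  eval-toPoly : ∀ {t} (w : Vecᶠ t) v → eval (toPoly w) v ≈ᵥ lincomb w (λ j → pow (toℕ j) v)
  eval-toPoly {zero}  w v k = refl
  eval-toPoly {suc t} w v k = +-congˡ (trans (cong M-linear (eval-toPoly (λ j → w (suc j)) v) k)
                                             (homo-lincomb M-linear (λ j → w (suc j)) (λ j → pow (toℕ j) v) k))

  -- The g with g(M) v₀ ∈ im w(M) form an ideal containing f and w. Dividing f by members of
  -- smaller and smaller degree, a nonzero member of least degree divides f, so it is a
  -- nonzero constant by irreducibility, which puts v₀ itself in the image.
  module Invertibility (_≟_ : Decidable _≈_) {f : Poly} {d : ℕ}
                       (f-irreducible : Irreducible f) (f-degree : HasDegree f d)
                       {v₀ : V} (f-kills-v₀ : eval f v₀ ≈ᵥ 𝟎) (w : Poly) where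

    InImage : V → Set (c ⊔ ℓ)
    InImage v = ∃[ y ] (eval w y ≈ᵥ v)

    image-cong : ∀ {u v} → u ≈ᵥ v → InImage u → InImage v
    image-cong u≈v (y , wy≈u) = y , λ k → trans (wy≈u k) (u≈v k)

    image-⊙ : ∀ a {v} → InImage v → InImage (a ⊙ v)
    image-⊙ a (y , wy≈v) = a ⊙ y , λ k → trans (homo-⊙ (eval-linear w) a y k) (*-congˡ (wy≈v k))

    image-eval : ∀ p {v} → InImage v → InImage (eval p v)
    image-eval p (y , wy≈v) = eval p y , λ k → trans (eval-comm w p y k) (cong (eval-linear p) wy≈v k)

    remainder-hits : ∀ h g r → f ≈ₚ ((h *ₚ g) +ₚ r) → InImage (eval g v₀) → InImage (eval r v₀)
    remainder-hits h g r f≈ g-hit = image-cong r≈ (image-⊙ (- 1#) (image-eval h g-hit))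
      where
      r≈ : (- 1#) ⊙ eval h (eval g v₀) ≈ᵥ eval r v₀
      r≈ k = sym (trans (inverseʳ-unique _ _ (begin
        eval h (eval g v₀) k + eval r v₀ k ≈⟨ +-congʳ (eval-*ₚ h g v₀ k) ⟨
        eval (h *ₚ g) v₀ k + eval r v₀ k   ≈⟨ eval-+ₚ (h *ₚ g) r v₀ k ⟨
        eval ((h *ₚ g) +ₚ r) v₀ k          ≈⟨ eval-cong {f} {(h *ₚ g) +ₚ r} v₀ f≈ k ⟨
        eval f v₀ k                        ≈⟨ f-kills-v₀ k ⟩
        0#                                 ∎)) (sym (-1*x≈-x _)))

    constant-hits : ∀ g → DegreeBelow g 1 → ¬ (coeff g 0 ≈ 0#) → InImage (eval g v₀) → InImage v₀
    constant-hits []      _   g₀≉0 _     = ⊥-elim (g₀≉0 refl)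
    constant-hits (a ∷ g) g<1 a≉0  g-hit = image-cong a⁻¹a·v₀≈v₀ (image-⊙ (a ⁻¹) (image-cong g·v₀≈a·v₀ g-hit))
      where
      g·v₀≈a·v₀ : eval (a ∷ g) v₀ ≈ᵥ a ⊙ v₀
      g·v₀≈a·v₀ k = trans (+-congˡ (trans (cong M-linear (eval-zero g v₀ (λ j → g<1 (suc j) (s≤s z≤n))) k)
                                          (homo-𝟎 M-linear k)))
                          (+-identityʳ _)
      a⁻¹a·v₀≈v₀ : (a ⁻¹) ⊙ a ⊙ v₀ ≈ᵥ v₀
      a⁻¹a·v₀≈v₀ k = trans (sym (*-assoc _ _ _)) (trans (*-congʳ (⁻¹-inverseˡ a a≉0)) (*-identityˡ _))

    factor-constant : ∀ {h g} → f ≈ₚ (h *ₚ g) → DegreeBelow g d → IsConstant g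
    factor-constant {h} {g} f≈hg g<d with proj₂ f-irreducible h g f≈hg
    ... | inj₂ g-constant = g-constant
    ... | inj₁ h-constant = ⊥-elim (proj₁ f-degree (begin
      coeff f d                ≈⟨ f≈hg d ⟩
      coeff (h *ₚ g) d         ≈⟨ coeff-*ₚ-constant h g h-constant d ⟩
      coeff h 0 * coeff g d    ≈⟨ *-congˡ (g<d d ℕₚ.≤-refl) ⟩
      coeff h 0 * 0#           ≈⟨ zeroʳ _ ⟩
      0#                       ∎))

    mutual
      zero-or-hits : ∀ B → B ≤ d → ∀ g → DegreeBelow g B → InImage (eval g v₀) →
                     (∀ k → coeff g k ≈ 0#) ⊎ InImage v₀
      zero-or-hits zero    _   g g<0   _     = inj₁ (λ k → g<0 k z≤n)
      zero-or-hits (suc B) B<d g g<B+1 g-hit with coeff g B ≟ 0#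
      ... | yes g_B≈0 = zero-or-hits B (ℕₚ.<⇒≤ B<d) g (degreeBelow-pred {g} g<B+1 g_B≈0) g-hit
      ... | no  g_B≉0 = inj₂ (hits B B<d g (g_B≉0 , g<B+1) g-hit)

      hits : ∀ B → B < d → ∀ g → HasDegree g B → InImage (eval g v₀) → InImage v₀
      hits zero    _     g (g₀≉0 , g<1) g-hit = constant-hits g g<1 g₀≉0 g-hit
      hits (suc e) e+1<d g g-degree g-hit =
        let h , r , r<e+1 , f≈ = division g-degree f
        in [ r-zero⇒hits h r f≈ , id ]′ (zero-or-hits (suc e) (ℕₚ.<⇒≤ e+1<d) r r<e+1 (remainder-hits h g r f≈ g-hit))
        where
        r-zero⇒hits : ∀ h r → f ≈ₚ ((h *ₚ g) +ₚ r) → (∀ k → coeff r k ≈ 0#) → InImage v₀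
        r-zero⇒hits h r f≈ r≈0 = ⊥-elim (proj₁ g-degree (g-constant (suc e) (s≤s z≤n)))
          where
          f≈hg : f ≈ₚ (h *ₚ g)
          f≈hg k = trans (f≈ k) (trans (coeff-+ₚ (h *ₚ g) r k) (trans (+-congˡ (r≈0 k)) (+-identityʳ _)))
          g-constant : IsConstant g
          g-constant = factor-constant {h} {g} f≈hg (hasDegree⇒degreeBelow {g} g-degree e+1<d)

    v₀∈image : DegreeBelow w d → ¬ (∀ k → coeff w k ≈ 0#) → InImage v₀
    v₀∈image w<d w≉0 = [ ⊥-elim ∘ w≉0 , id ]′ (zero-or-hits d ℕₚ.≤-refl w w<d (v₀ , λ _ → refl))

module MultiplicationByRoot {c ℓ} (F : Field c ℓ) (f : FieldTheory.Poly F) (m : ℕ) where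
  open Field F hiding (zero)
  open FieldTheory F
  open LinearAlgebra F
  open Polynomials F
  open FieldProperties F using (x+y*-[y⁻¹*x]≈0)
  open import Algebra.Properties.Ring ring using (-1*x≈-x; -‿distribˡ-*)
  open import Algebra.Properties.AbelianGroup +-abelianGroup using (x∙y⁻¹≈ε⇒x≈y)
  open import Algebra.Properties.CommutativeSemigroup +-commutativeSemigroup using (interchange)
  open import Algebra.Properties.CommutativeSemigroup *-commutativeSemigroup using (x∙yz≈y∙xz)
  open import Relation.Binary.Reasoning.Setoid setoid

  private
    d : ℕ
    d = suc m
    V : Set c
    V = Vecᶠ d
    last : Fin d
    last = fromℕ m

  shift : V → V
  shift u zero    = 0#
  shift u (suc j) = u (inject₁ j)

  ωᵈ : V
  ωᵈ k = - (coeff f d ⁻¹ * coeff f (toℕ k))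

  mulω-≈ : ∀ u k → mulω f d u k ≈ shift u k + ωᵈ k * u last
  mulω-≈ u zero    = +-congˡ (-‿distribˡ-* _ _)
  mulω-≈ u (suc j) = +-congˡ (-‿distribˡ-* _ _)

  shift-linear : IsLinear shift
  shift-linear = record { cong = shift-cong ; homo-⊕ = shift-⊕ ; homo-⊙ = shift-⊙ }
    where
    shift-cong : ∀ {u v} → u ≈ᵥ v → shift u ≈ᵥ shift v
    shift-cong u≈v zero    = refl
    shift-cong u≈v (suc j) = u≈v (inject₁ j)
    shift-⊕ : ∀ u v → shift (u ⊕ v) ≈ᵥ shift u ⊕ shift v
    shift-⊕ u v zero    = sym (+-identityʳ 0#)
    shift-⊕ u v (suc j) = refl
    shift-⊙ : ∀ a u → shift (a ⊙ u) ≈ᵥ a ⊙ shift u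
    shift-⊙ a u zero    = sym (zeroʳ a)
    shift-⊙ a u (suc j) = refl

  mulω-linear : IsLinear (mulω f d)
  mulω-linear = record { cong = mulω-cong ; homo-⊕ = mulω-⊕ ; homo-⊙ = mulω-⊙ }
    where
    mulω-cong : ∀ {u v} → u ≈ᵥ v → mulω f d u ≈ᵥ mulω f d v
    mulω-cong {u} {v} u≈v k = begin
      mulω f d u k               ≈⟨ mulω-≈ u k ⟩
      shift u k + ωᵈ k * u last  ≈⟨ +-cong (cong shift-linear u≈v k) (*-congˡ (u≈v last)) ⟩
      shift v k + ωᵈ k * v last  ≈⟨ mulω-≈ v k ⟨
      mulω f d v k               ∎
    mulω-⊕ : ∀ u v → mulω f d (u ⊕ v) ≈ᵥ mulω f d u ⊕ mulω f d v
    mulω-⊕ u v k = begin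
      mulω f d (u ⊕ v) k
        ≈⟨ mulω-≈ (u ⊕ v) k ⟩
      shift (u ⊕ v) k + ωᵈ k * (u last + v last)
        ≈⟨ +-cong (homo-⊕ shift-linear u v k) (distribˡ _ _ _) ⟩
      (shift u k + shift v k) + (ωᵈ k * u last + ωᵈ k * v last)
        ≈⟨ interchange _ _ _ _ ⟩
      (shift u k + ωᵈ k * u last) + (shift v k + ωᵈ k * v last)
        ≈⟨ +-cong (mulω-≈ u k) (mulω-≈ v k) ⟨
      mulω f d u k + mulω f d v k ∎
    mulω-⊙ : ∀ a u → mulω f d (a ⊙ u) ≈ᵥ a ⊙ mulω f d u
    mulω-⊙ a u k = begin
      mulω f d (a ⊙ u) k                     ≈⟨ mulω-≈ (a ⊙ u) k ⟩
      shift (a ⊙ u) k + ωᵈ k * (a * u last)  ≈⟨ +-cong (homo-⊙ shift-linear a u k) (x∙yz≈y∙xz _ _ _) ⟩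
      a * shift u k + a * (ωᵈ k * u last)    ≈⟨ distribˡ a _ _ ⟨
      a * (shift u k + ωᵈ k * u last)        ≈⟨ *-congˡ (mulω-≈ u k) ⟨
      a * mulω f d u k                       ∎

  open Horner F (mulω f d) mulω-linear public

  powω≈pow : ∀ i v → powω f d i v ≈ᵥ pow i v
  powω≈pow zero    v k = refl
  powω≈pow (suc i) v   = cong mulω-linear (powω≈pow i v)

  mulω-𝐞 : ∀ j → mulω f d (𝐞 j) ≈ᵥ 𝐞 (suc j) ⊕ δ m j ⊙ ωᵈ
  mulω-𝐞 j k = begin
    mulω f d (𝐞 j) k                 ≈⟨ mulω-≈ (𝐞 j) k ⟩
    shift (𝐞 j) k + ωᵈ k * 𝐞 j last  ≈⟨ +-cong (shift-𝐞 k) (trans (*-congˡ 𝐞-last) (*-comm _ _)) ⟩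
    𝐞 (suc j) k + δ m j * ωᵈ k       ∎
    where
    shift-𝐞 : ∀ k → shift (𝐞 j) k ≈ 𝐞 (suc j) k
    shift-𝐞 zero    = refl
    shift-𝐞 (suc i) = reflexive (≡.cong (λ t → δ t j) (Finₚ.toℕ-inject₁ i))
    𝐞-last : 𝐞 j last ≈ δ m j
    𝐞-last = reflexive (≡.cong (λ t → δ t j) (Finₚ.toℕ-fromℕ m))

  pow-oneω-< : ∀ j → j < d → pow j oneω ≈ᵥ 𝐞 j
  pow-oneω-< zero    _         zero    = refl
  pow-oneω-< zero    _         (suc k) = refl
  pow-oneω-< (suc j) (s≤s j<m) k       = begin
    mulω f d (pow j oneω) k     ≈⟨ cong mulω-linear (pow-oneω-< j (ℕₚ.m<n⇒m<1+n j<m)) k ⟩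
    mulω f d (𝐞 j) k            ≈⟨ mulω-𝐞 j k ⟩
    𝐞 (suc j) k + δ m j * ωᵈ k  ≈⟨ +-congˡ (*-congʳ (reflexive (≡.trans (δ-sym m j) (δ-< j<m)))) ⟩
    𝐞 (suc j) k + 0# * ωᵈ k     ≈⟨ +-congˡ (zeroˡ _) ⟩
    𝐞 (suc j) k + 0#            ≈⟨ +-identityʳ _ ⟩
    𝐞 (suc j) k                 ∎

  pow-oneω-d : pow d oneω ≈ᵥ ωᵈ
  pow-oneω-d k = begin
    mulω f d (pow m oneω) k  ≈⟨ cong mulω-linear (pow-oneω-< m (ℕₚ.n<1+n m)) k ⟩
    mulω f d (𝐞 m) k         ≈⟨ mulω-𝐞 m k ⟩
    𝐞 d k + δ m m * ωᵈ k     ≈⟨ +-cong (reflexive (δ-< (Finₚ.toℕ<n k))) (*-congʳ (reflexive (δ-diag m))) ⟩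
    0# + 1# * ωᵈ k           ≈⟨ trans (+-identityˡ _) (*-identityˡ _) ⟩
    ωᵈ k                     ∎

  eval-toPoly-oneω : (w : V) → eval (toPoly w) oneω ≈ᵥ w
  eval-toPoly-oneω w k = begin
    eval (toPoly w) oneω k                      ≈⟨ eval-toPoly w oneω k ⟩
    lincomb w (λ j → pow (toℕ j) oneω) k        ≈⟨ sumᶠ-cong (λ j → *-congˡ {w j} (pow-oneω-< (toℕ j) (Finₚ.toℕ<n j) k)) ⟩
    lincomb w (λ j → 𝐞 (toℕ j)) k               ≈⟨ lincomb-𝐞 w k ⟩
    w k                                         ∎

  module _ (f-degree : HasDegree f d) where

    f-kills-oneω : eval f oneω ≈ᵥ 𝟎
    f-kills-oneω k = begin
      eval f oneω k
        ≈⟨ eval-cong {f} {low +ₚ monomial lc d} oneω (split-leading {f} f-degree) k ⟩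
      eval (low +ₚ monomial lc d) oneω k
        ≈⟨ eval-+ₚ low (monomial lc d) oneω k ⟩
      eval low oneω k + eval (monomial lc d) oneω k
        ≈⟨ +-cong (eval-toPoly-oneω (λ j → coeff f (toℕ j)) k) (eval-monomial lc d oneω k) ⟩
      coeff f (toℕ k) + lc * pow d oneω k
        ≈⟨ +-congˡ (*-congˡ (pow-oneω-d k)) ⟩
      coeff f (toℕ k) + lc * ωᵈ k
        ≈⟨ x+y*-[y⁻¹*x]≈0 _ lc (proj₁ f-degree) ⟩
      0# ∎
      where
      lc  = coeff f d
      low = toPoly {d} (λ j → coeff f (toℕ j))

    f-kills : ∀ v → eval f v ≈ᵥ 𝟎
    f-kills v k = begin
      eval f v k                            ≈⟨ cong (eval-linear f) (eval-toPoly-oneω v) k ⟨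
      eval f (eval (toPoly v) oneω) k       ≈⟨ eval-comm f (toPoly v) oneω k ⟩
      eval (toPoly v) (eval f oneω) k       ≈⟨ cong (eval-linear (toPoly v)) f-kills-oneω k ⟩
      eval (toPoly v) 𝟎 k                   ≈⟨ homo-𝟎 (eval-linear (toPoly v)) k ⟩
      0#                                    ∎

    pow-periodic : ∀ {n} → f ∣ₚ xⁿ-1 n → ∀ v → pow n v ≈ᵥ v
    pow-periodic {n} (h , f*h≈xⁿ-1) v k = x∙y⁻¹≈ε⇒x≈y _ _ (begin
      pow n v k + - v k
        ≈⟨ +-cong (*-identityˡ _) (trans (+-congˡ (homo-𝟎 mulω-linear k)) (trans (+-identityʳ _) (-1*x≈-x _))) ⟨
      1# * pow n v k + ((- 1#) * v k + mulω f d 𝟎 k)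
        ≈⟨ +-congʳ (eval-monomial 1# n v k) ⟨
      eval (monomial 1# n) v k + eval ((- 1#) ∷ []) v k
        ≈⟨ eval-+ₚ (monomial 1# n) ((- 1#) ∷ []) v k ⟨
      eval (xⁿ-1 n) v k
        ≈⟨ eval-cong {xⁿ-1 n} {f *ₚ h} v (λ j → sym (f*h≈xⁿ-1 j)) k ⟩
      eval (f *ₚ h) v k
        ≈⟨ eval-*ₚ f h v k ⟩
      eval f (eval h v) k
        ≈⟨ f-kills (eval h v) k ⟩
      0# ∎)

  pow≈lincomb : ∀ i v → pow i v ≈ᵥ lincomb (pow i oneω) (λ j → pow (toℕ j) v)
  pow≈lincomb i v k = begin
    pow i v k                                           ≈⟨ cong (pow-linear i) (eval-toPoly-oneω v) k ⟨
    pow i (eval (toPoly v) oneω) k                      ≈⟨ eval-pow (toPoly v) i oneω k ⟨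
    eval (toPoly v) (pow i oneω) k                      ≈⟨ cong (eval-linear (toPoly v)) (eval-toPoly-oneω (pow i oneω)) k ⟨
    eval (toPoly v) (eval (toPoly (pow i oneω)) oneω) k ≈⟨ eval-comm (toPoly v) (toPoly (pow i oneω)) oneω k ⟩
    eval (toPoly (pow i oneω)) (eval (toPoly v) oneω) k ≈⟨ cong (eval-linear (toPoly (pow i oneω))) (eval-toPoly-oneω v) k ⟩
    eval (toPoly (pow i oneω)) v k                      ≈⟨ eval-toPoly (pow i oneω) v k ⟩
    lincomb (pow i oneω) (λ j → pow (toℕ j) v) k        ∎

module FiniteLinearAlgebra {c ℓ q} (FF : FiniteField c ℓ q) where
  open FiniteField FF hiding (zero)
  open FieldTheory field′
  open LinearAlgebra field′
  open import Algebra.Properties.Ring ring using (-1*x≈-x)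
  open import Algebra.Properties.AbelianGroup +-abelianGroup using (x∙y⁻¹≈ε⇒x≈y)
  open import Data.Product.Properties using (×-≡,≡→≡)
  open import Relation.Binary.Reasoning.Setoid setoid

  enumᵛ : ∀ t → Fin (q ℕ.^ t) → Vecᶠ t
  enumᵛ (suc t) i zero    = enum (proj₁ (Fin.remQuot {q} (q ℕ.^ t) i))
  enumᵛ (suc t) i (suc j) = enumᵛ t (proj₂ (Fin.remQuot {q} (q ℕ.^ t) i)) j

  enumᵛ-surjective : ∀ t (v : Vecᶠ t) → ∃[ i ] (enumᵛ t i ≈ᵥ v)
  enumᵛ-surjective zero    v = zero , λ ()
  enumᵛ-surjective (suc t) v with enum-surj (v zero) | enumᵛ-surjective t (λ k → v (suc k))
  ... | a , enum-a≈v₀ | r , enum-r≈v′ = Fin.combine a r , enum≈v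
    where
    split = Finₚ.remQuot-combine {q} {q ℕ.^ t} a r
    enum≈v : enumᵛ (suc t) (Fin.combine a r) ≈ᵥ v
    enum≈v zero    = trans (reflexive (≡.cong (λ (a′ , _) → enum a′) split)) enum-a≈v₀
    enum≈v (suc j) = trans (reflexive (≡.cong (λ (_ , r′) → enumᵛ t r′ j) split)) (enum-r≈v′ j)

  enumᵛ-injective : ∀ t {i j} → enumᵛ t i ≈ᵥ enumᵛ t j → i ≡ j
  enumᵛ-injective zero    {zero} {zero} _ = ≡.refl
  enumᵛ-injective (suc t) {i}    {j}    i≈j =
    ≡.trans (≡.sym (Finₚ.combine-remQuot {q} (q ℕ.^ t) i))
            (≡.trans (≡.cong (uncurry Fin.combine) (×-≡,≡→≡ (quotients , remainders)))
                     (Finₚ.combine-remQuot {q} (q ℕ.^ t) j))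
    where
    quotients  = enum-inj _ _ (i≈j zero)
    remainders = enumᵛ-injective t (λ k → i≈j (suc k))

  1<q : 1 < q
  1<q = onto-size enum enum-surj
    where
    onto-size : ∀ {Q} (e : Fin Q → Carrier) → (∀ x → ∃[ i ] (e i ≈ x)) → 1 < Q
    onto-size {zero} e onto with onto 0#
    ... | () , _
    onto-size {suc zero} e onto with onto 0# | onto 1#
    ... | zero , e₀≈0 | zero , e₀≈1 = ⊥-elim (0≉1 (trans (sym e₀≈0) e₀≈1))
    onto-size {suc (suc Q)} _ _ = s≤s (s≤s z≤n)

  -- G sends the q^(t+1) vectors of F^(t+1) to the q^t vectors of F^t, so two of them
  -- collide and their difference is in the kernel.
  kernel-nontrivial : ∀ {t} {G : Vecᶠ (suc t) → Vecᶠ t} → IsLinear G → ∃[ w ] (¬ (w ≈ᵥ 𝟎) × G w ≈ᵥ 𝟎)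
  kernel-nontrivial {t} {G} G-linear =
    let i , j , i<j , same-code = Finₚ.pigeonhole (ℕₚ.^-monoʳ-< q 1<q (ℕₚ.n<1+n t)) code
    in difference i j (Finₚ.<⇒≢ i<j) same-code
    where
    code : Fin (q ℕ.^ suc t) → Fin (q ℕ.^ t)
    code i = proj₁ (enumᵛ-surjective t (G (enumᵛ (suc t) i)))

    decode-code : ∀ i → enumᵛ t (code i) ≈ᵥ G (enumᵛ (suc t) i)
    decode-code i = proj₂ (enumᵛ-surjective t (G (enumᵛ (suc t) i)))

    difference : ∀ i j → i ≢ j → code i ≡ code j → ∃[ w ] (¬ (w ≈ᵥ 𝟎) × G w ≈ᵥ 𝟎)
    difference i j i≢j same-code = u ⊕ (- 1#) ⊙ v , u-v≉𝟎 , G[u-v]≈𝟎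
      where
      u v : Vecᶠ (suc t)
      u = enumᵛ (suc t) i
      v = enumᵛ (suc t) j
      Gu≈Gv : G u ≈ᵥ G v
      Gu≈Gv k = trans (sym (decode-code i k)) (trans (reflexive (≡.cong (λ e → enumᵛ t e k) same-code)) (decode-code j k))
      G[u-v]≈𝟎 : G (u ⊕ (- 1#) ⊙ v) ≈ᵥ 𝟎
      G[u-v]≈𝟎 k = begin
        G (u ⊕ (- 1#) ⊙ v) k        ≈⟨ homo-⊕ G-linear u _ k ⟩
        G u k + G ((- 1#) ⊙ v) k    ≈⟨ +-congˡ (homo-⊙ G-linear (- 1#) v k) ⟩
        G u k + (- 1#) * G v k      ≈⟨ +-congˡ (trans (-1*x≈-x _) (-‿cong (sym (Gu≈Gv k)))) ⟩
        G u k + - G u k             ≈⟨ -‿inverseʳ _ ⟩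
        0#                          ∎
      u-v≉𝟎 : ¬ (u ⊕ (- 1#) ⊙ v ≈ᵥ 𝟎)
      u-v≉𝟎 u-v≈𝟎 =
        i≢j (enumᵛ-injective (suc t) (λ k → x∙y⁻¹≈ε⇒x≈y _ _ (trans (+-congˡ (sym (-1*x≈-x _))) (u-v≈𝟎 k))))

module Covering {c ℓ q} (FF : FiniteField c ℓ q) (f : FieldTheory.Poly (FiniteField.field′ FF)) (m : ℕ) where
  open FiniteField FF hiding (zero)
  open FieldTheory field′
  open LinearAlgebra field′
  open Polynomials field′
  open MultiplicationByRoot field′ f m
  open FiniteLinearAlgebra FF
  open import Relation.Binary.Reasoning.Setoid setoid

  private
    d : ℕ
    d = suc m

  CoveredBy : ℕ → Subspace d → Vecᶠ d → Set (c ⊔ ℓ)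
  CoveredBy n W v = ∃[ i ] (i < n × ∃[ u ] (Subspace.member W u × (v ≈ᵥ powω f d i u)))

  Covers : ℕ → Subspace d → Set (c ⊔ ℓ)
  Covers n W = ∀ v → CoveredBy n W v

  Condition : ℕ → Set (c ⊔ ℓ)
  Condition n = ∀ (x : Vecᶠ d) → (∀ j → ¬ (x j ≈ 0#)) → ∃[ i ] (d ≤ i × i ≤ n × x · coord f d i ≈ 0#)

  hyperplane : Subspace d
  hyperplane = record
    { member  = λ v → Lift c (v zero ≈ 0#)
    ; respect = λ u≈v (lift u₀≈0) → lift (trans (sym (u≈v zero)) u₀≈0)
    ; has-0   = lift refl
    ; closed+ = λ (lift u₀≈0) (lift v₀≈0) → lift (trans (+-cong u₀≈0 v₀≈0) (+-identityʳ 0#))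
    ; closed* = λ a (lift u₀≈0) → lift (trans (*-congˡ u₀≈0) (zeroʳ a))
    }

  hyperplane-dim : HasDim hyperplane m
  hyperplane-dim = basis , independent , (λ _ → lift refl) , spans
    where
    basis : Fin m → Vecᶠ d
    basis s = 𝐞 (suc (toℕ s))
    independent : LinIndep basis
    independent cs cs·basis≈0 s = trans (sym (lincomb-𝐞 cs s)) (cs·basis≈0 (suc s))
    spans : ∀ v → Lift c (v zero ≈ 0#) → ∃[ cs ] (v ≈ᵥ lincomb cs basis)
    spans v (lift v₀≈0) = (λ s → v (suc s)) , v≈
      where
      v≈ : v ≈ᵥ lincomb (λ s → v (suc s)) basis
      v≈ zero    = trans v₀≈0 (sym (sumᶠ-zero (λ s → v (suc s) * 0#) (λ _ → zeroʳ _)))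
      v≈ (suc k) = sym (lincomb-𝐞 (λ s → v (suc s)) k)

  orbit₀ : Vecᶠ d → Vecᶠ d
  orbit₀ v j = pow (toℕ j) v zero

  pow-zero-coordinate : ∀ i v → pow i v zero ≈ orbit₀ v · coord f d i
  pow-zero-coordinate i v = begin
    pow i v zero                                     ≈⟨ pow≈lincomb i v zero ⟩
    lincomb (pow i oneω) (λ j → pow (toℕ j) v) zero  ≈⟨ sumᶠ-cong (λ j → *-comm (pow i oneω j) (orbit₀ v j)) ⟩
    orbit₀ v · pow i oneω                            ≈⟨ ·-cong (orbit₀ v) (powω≈pow i oneω) ⟨
    orbit₀ v · coord f d i                           ∎

  annihilating-polynomial : ∀ {W} → HasDim W m → ∀ x →
                            ∃[ w ] (¬ (w ≈ᵥ 𝟎) × (∀ u → Subspace.member W u → x · eval (toPoly w) u ≈ 0#))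
  annihilating-polynomial {W} (b , _ , _ , spans) x =
    let w , w≉𝟎 , Σwa≈𝟎 = kernel-nontrivial (lincomb-linear a) in w , w≉𝟎 , x·w[W]≈0 w Σwa≈𝟎
    where
    a : Fin d → Vecᶠ m
    a j s = x · pow (toℕ j) (b s)

    x·w[b]≈0 : ∀ w → lincomb w a ≈ᵥ 𝟎 → ∀ s → x · eval (toPoly w) (b s) ≈ 0#
    x·w[b]≈0 w Σwa≈𝟎 s = begin
      x · eval (toPoly w) (b s)                ≈⟨ ·-cong x (eval-toPoly w (b s)) ⟩
      x · lincomb w (λ j → pow (toℕ j) (b s))  ≈⟨ ·-lincomb x w (λ j → pow (toℕ j) (b s)) ⟩
      lincomb w a s                            ≈⟨ Σwa≈𝟎 s ⟩
      0#                                       ∎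

    x·w[W]≈0 : ∀ w → lincomb w a ≈ᵥ 𝟎 → ∀ u → Subspace.member W u → x · eval (toPoly w) u ≈ 0#
    x·w[W]≈0 w Σwa≈𝟎 u u∈W =
      let cs , u≈Σcsb = spans u u∈W in begin
      x · eval (toPoly w) u                          ≈⟨ ·-cong x (cong (eval-linear (toPoly w)) u≈Σcsb) ⟩
      x · eval (toPoly w) (lincomb cs b)             ≈⟨ ·-cong x (homo-lincomb (eval-linear (toPoly w)) cs b) ⟩
      x · lincomb cs (λ s → eval (toPoly w) (b s))   ≈⟨ ·-lincomb x cs (λ s → eval (toPoly w) (b s)) ⟩
      sumᶠ (λ s → cs s * x · eval (toPoly w) (b s))  ≈⟨ sumᶠ-zero _ (λ s → trans (*-congˡ (x·w[b]≈0 w Σwa≈𝟎 s)) (zeroʳ _)) ⟩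
      0#                                             ∎

  module _ (f-degree : HasDegree f d) {n : ℕ} (f∣xⁿ-1 : f ∣ₚ xⁿ-1 n) where

    private
      periodic : ∀ v → pow n v ≈ᵥ v
      periodic = pow-periodic f-degree {n} f∣xⁿ-1

    covered-through-hyperplane : 1 ≤ n → ∀ k v → pow k v zero ≈ 0# → CoveredBy n hyperplane v
    covered-through-hyperplane n≥1 k v ωᵏv∈W =
      let i , i<n , ωⁱωᵏv≈v = pow-inverse n≥1 periodic k v
      in i , i<n , pow k v , lift ωᵏv∈W , λ j → sym (trans (powω≈pow i (pow k v) j) (ωⁱωᵏv≈v j))

    condition⇒covering : 1 ≤ n → Condition n → Covers n hyperplane
    condition⇒covering n≥1 condition v = by-cases (Finₚ.any? (λ j → orbit₀ v j ≟ 0#))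
      where
      by-cases : Dec (∃[ j ] (orbit₀ v j ≈ 0#)) → CoveredBy n hyperplane v
      by-cases (yes (j , ωʲv∈W)) = covered-through-hyperplane n≥1 (toℕ j) v ωʲv∈W
      by-cases (no ∄j) =
        let i , _ , _ , orbit·ωⁱ≈0 = condition (orbit₀ v) (λ j ωʲv∈W → ∄j (j , ωʲv∈W))
        in covered-through-hyperplane n≥1 i v (trans (pow-zero-coordinate i v) orbit·ωⁱ≈0)

    power-in-kernel : Irreducible f → ∀ {W} → HasDim W m → Covers n W →
                      ∀ x → ∃[ j ] (j ≤ n × x · pow j oneω ≈ 0#)
    power-in-kernel f-irreducible {W} W-dim covers x =
      let w , w≉𝟎 , x·w[W]≈0 = annihilating-polynomial {W} W-dim x
          y , w[y]≈1 = Invertibility.v₀∈image _≟_ {f} f-irreducible f-degree (f-kills-oneω f-degree)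
                         (toPoly w) (toPoly-degree w) (w≉𝟎 ∘ toPoly-zero w)
          i , i<n , u , u∈W , y≈ωⁱu = covers y
      in n ∸ i , ℕₚ.m∸n≤m n i , (begin
        x · pow (n ∸ i) oneω   ≈⟨ ·-cong x (pow-undo periodic (ℕₚ.<⇒≤ i<n) (ωⁱ[wu]≈1 w y i u w[y]≈1 y≈ωⁱu)) ⟨
        x · eval (toPoly w) u  ≈⟨ x·w[W]≈0 u u∈W ⟩
        0#                     ∎)
      where
      ωⁱ[wu]≈1 : ∀ w y i u → eval (toPoly w) y ≈ᵥ oneω → y ≈ᵥ powω f d i u → pow i (eval (toPoly w) u) ≈ᵥ oneω
      ωⁱ[wu]≈1 w y i u w[y]≈1 y≈ωⁱu k = begin
        pow i (eval (toPoly w) u) k  ≈⟨ eval-pow (toPoly w) i u k ⟨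
        eval (toPoly w) (pow i u) k  ≈⟨ cong (eval-linear (toPoly w)) (λ j → trans (y≈ωⁱu j) (powω≈pow i u j)) k ⟨
        eval (toPoly w) y k          ≈⟨ w[y]≈1 k ⟩
        oneω k                       ∎

    covering⇒condition : Irreducible f → ∀ {W} → HasDim W m → Covers n W → Condition n
    covering⇒condition f-irreducible {W} W-dim covers x x≉0 =
      let j , j≤n , x·ωʲ≈0 = power-in-kernel f-irreducible {W} W-dim covers x
      in j , d≤j j x·ωʲ≈0 , j≤n , trans (·-cong x (powω≈pow j oneω)) x·ωʲ≈0
      where
      d≤j : ∀ j → x · pow j oneω ≈ 0# → d ≤ j
      d≤j j x·ωʲ≈0 = ℕₚ.≮⇒≥ λ j<d → x≉0 (fromℕ< j<d) (begin
        x (fromℕ< j<d)             ≈⟨ ·-𝐞 x (fromℕ< j<d) ⟨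
        x · 𝐞 (toℕ (fromℕ< j<d))   ≡⟨ ≡.cong (λ e → x · 𝐞 e) (Finₚ.toℕ-fromℕ< j<d) ⟩
        x · 𝐞 j                    ≈⟨ ·-cong x (pow-oneω-< j j<d) ⟨
        x · pow j oneω             ≈⟨ x·ωʲ≈0 ⟩
        0#                         ∎)

theorem3p2 : ∀ {c ℓ} (q : ℕ) → IsPrimePower q → (F : FiniteField c ℓ q) →
    let open FiniteField F
        open FieldTheory field′
    in (n : ℕ) → 1 ≤ n → (f : Poly) (d : ℕ) → HasDegree f d → Irreducible f → f ∣ₚ xⁿ-1 n →
      (∃[ V ] (HasDim {d} V (d ∸ 1)
               × (∀ v → ∃[ i ] (i < n × ∃[ u ] (Subspace.member V u × (v ≈ᵥ powω f d i u))))))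
      ⇔ (∀ (x : Vecᶠ d) → (∀ j → ¬ (x j ≈ 0#))
           → ∃[ i ] (d ≤ i × i ≤ n × (sumᶠ (λ j → x j * coord f d i j) ≈ 0#)))
theorem3p2 q _ F n n≥1 f zero    (_ , f-top) (f-nonconstant , _) _ = ⊥-elim (f-nonconstant f-top)
theorem3p2 q _ F n n≥1 f (suc m) f-degree f-irreducible f∣xⁿ-1 = mk⇔
  (λ (W , W-dim , W-covers) → covering⇒condition f-degree f∣xⁿ-1 f-irreducible {W} W-dim W-covers)
  (λ condition → hyperplane , hyperplane-dim , condition⇒covering f-degree f∣xⁿ-1 n≥1 condition)
  where open Covering F f m
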